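{- Let $G$ be the $3$-uniform tight cycle on $n\ge 4$ vertices: vertex set $[n]$ (labels modulo $n$) and edges $\{j+1,j+2,j+3\}$ for $j=0,\dots,n-1$. Then the maximum degree is $\Delta=3$. If $n=4$, then $\lambda(\mathcal L)=4$. If $n\ge 5$, then $\lambda(\mathcal L)\le\Delta+1.5=4.5$.
   Context: For a $3$-uniform hypergraph on $[n]$ with degrees $d_i$ (number of edges containing $i$), a real $\lambda$ is a Laplacian H-eigenvalue if some $\mathbf x\in\mathbb R^n\setminus\{0\}$ satisfies $\lambda x_i^{2}=d_ix_i^{2}-\sum_{\{i,a,b\}\in E}x_ax_b$ for all $i$, i.e. $\lambda$ is an H-eigenvalue of the Laplacian tensor $\mathcal L=\mathcal D-\mathcal A$ ($\mathcal A$ the adjacency tensor with entries $1/2$ on edges, $\mathcal D$ the diagonal degree tensor). $\lambda(\mathcal L)$ is the largest Laplacian H-eigenvalue. -}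

module Defs where

open import Level using (Level; _⊔_) renaming (suc to lsuc)
open import Algebra.Bundles using (CommutativeRing)
open import Relation.Binary.Structures using (IsTotalOrder)
open import Relation.Nullary using (¬_; yes; no)
open import Data.Product using (_×_; _,_; ∃-syntax)
open import Data.Nat as ℕ using (ℕ; zero; suc; _%_)
open import Data.Nat.DivMod using (m%n<n)
open import Data.Fin as Fin using (Fin; toℕ; fromℕ<; _≟_)
open import Data.List using (List; []; _∷_; map; foldr; length; filter)
open import Data.List using (allFin)
open import Data.Sum using (_⊎_)
open import Relation.Binary.PropositionalEquality using (_≡_)
open import Relation.Nullary using (Dec)
open import Relation.Nullary.Decidable using (_⊎-dec_)

record OrderedField (c ℓ₁ ℓ₂ : Level) : Set (lsuc (c ⊔ ℓ₁ ⊔ ℓ₂)) where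
  field
    commutativeRing : CommutativeRing c ℓ₁
  open CommutativeRing commutativeRing public
  field
    _≤_         : Carrier → Carrier → Set ℓ₂
    isTotalOrder : IsTotalOrder _≈_ _≤_
    +-mono-≤    : ∀ {x y} z → x ≤ y → (x + z) ≤ (y + z)
    *-nonneg    : ∀ {x y} → 0# ≤ x → 0# ≤ y → 0# ≤ (x * y)
    nontrivial  : ¬ (0# ≈ 1#)
    inverse     : ∀ x → ¬ (x ≈ 0#) → ∃[ y ] ((x * y) ≈ 1#)

  fromℕ : ℕ → Carrier
  fromℕ zero    = 0#
  fromℕ (suc k) = 1# + fromℕ k

-- 3-uniform hypergraphs on Fin n, edges given as a list of triples
-- of (pairwise distinct) vertices.

Edge : ℕ → Set
Edge n = Fin n × Fin n × Fin n

Hypergraph3 : ℕ → Set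
Hypergraph3 n = List (Edge n)

_∈ₑ_ : ∀ {n} → Fin n → Edge n → Set
i ∈ₑ (a , b , c) = (i ≡ a) ⊎ ((i ≡ b) ⊎ (i ≡ c))

_∈ₑ?_ : ∀ {n} (i : Fin n) → (e : Edge n) → Dec (i ∈ₑ e)
i ∈ₑ? (a , b , c) = (i ≟ a) ⊎-dec ((i ≟ b) ⊎-dec (i ≟ c))

degree : ∀ {n} → Hypergraph3 n → Fin n → ℕ
degree G i = length (filter (i ∈ₑ?_) G)

maxDegree : ∀ {n} → Hypergraph3 n → ℕ
maxDegree {n} G = foldr (λ i m → degree G i ℕ.⊔ m) 0 (allFin n)

vtx : (n : ℕ) → ℕ → Fin (suc n)
vtx n k = fromℕ< (m%n<n k (suc n))

tightCycle : (n : ℕ) → Hypergraph3 n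
tightCycle zero    = []
tightCycle (suc m) =
  map (λ j → vtx m (toℕ j ℕ.+ 1) , vtx m (toℕ j ℕ.+ 2) , vtx m (toℕ j ℕ.+ 3))
      (allFin (suc m))

module _ {c ℓ₁ ℓ₂} (F : OrderedField c ℓ₁ ℓ₂) where
  open OrderedField F

  Σₑ : ∀ {n} → Hypergraph3 n → (Edge n → Carrier) → Carrier
  Σₑ G f = foldr (λ e s → f e + s) 0# G

  adjTerm : ∀ {n} → (Fin n → Carrier) → Fin n → Edge n → Carrier
  adjTerm x i (a , b , c) with i ≟ a | i ≟ b | i ≟ c
  ... | yes _ | _     | _     = x b * x c
  ... | no _  | yes _ | _     = x a * x c
  ... | no _  | no _  | yes _ = x a * x b
  ... | no _  | no _  | no _  = 0#

  IsHEigenpair : ∀ {n} → Hypergraph3 n → Carrier → (Fin n → Carrier) → Set ℓ₁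
  IsHEigenpair G λ' x =
    (∃[ i ] ¬ (x i ≈ 0#)) ×
    (∀ i → (λ' * (x i * x i)) ≈ ((fromℕ (degree G i) * (x i * x i)) - Σₑ G (adjTerm x i)))

  IsLaplacianHEigenvalue : ∀ {n} → Hypergraph3 n → Carrier → Set (c ⊔ ℓ₁)
  IsLaplacianHEigenvalue {n} G λ' = ∃[ x ] IsHEigenpair {n} G λ' x

  IsLargestLaplacianHEigenvalue : ∀ {n} → Hypergraph3 n → Carrier → Set (c ⊔ ℓ₁ ⊔ ℓ₂)
  IsLargestLaplacianHEigenvalue G λ' =
    IsLaplacianHEigenvalue G λ' × (∀ μ → IsLaplacianHEigenvalue G μ → μ ≤ λ')

-- The edge {j+1, j+2, j+3} consists of three consecutive vertices, so for n ≥ 3 the edges have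
-- distinct vertices and every vertex lies in exactly three of them.  Summing the eigen-equations
-- μ x_i² = 3 x_i² − Σ_{ {i,a,b} ∈ E } x_a x_b over all vertices gives μ S + P = 3 S, where
-- S = Σ_i x_i² > 0 and P = Σ_{ {a,b,c} ∈ E } (x_a x_b + x_a x_c + x_b x_c).  Regularity also gives
-- Σ_E (x_a + x_b + x_c)² = 3 S + 2 P, hence 2μ S + Σ_E (x_a + x_b + x_c)² = 9 S and 2μ ≤ 9, already
-- for n ≥ 3.  For n = 4 every pair of vertices lies in two edges, so (Σ_i x_i)² = S + P and
-- μ S + (Σ_i x_i)² = 4 S, i.e. μ ≤ 4, with equality at x = (1, 1, −1, −1).
module Submission where

open import Defs
open import Algebra.Bundles using (CommutativeMonoid)
open import Data.Bool using (true; false; if_then_else_)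
open import Data.Empty using (⊥-elim)
open import Data.Fin as Fin using (Fin; toℕ; _≟_)
open import Data.Fin.Patterns using (0F; 1F; 2F; 3F)
import Data.Fin.Properties as Finₚ
open import Data.List using ([]; _∷_; filter; length; tabulate; foldr)
open import Data.List.Properties using (map-tabulate)
open import Data.List.Relation.Unary.All as All using (All; []; _∷_)
open import Data.List.Relation.Unary.All.Properties using (map⁺; tabulate⁺)
open import Data.Nat as ℕ using (ℕ; zero; suc; _<_; s≤s; z≤n)
open import Data.Product using (_×_; _,_; ∃-syntax)
open import Data.Sum using (inj₁; inj₂)
open import Function using (_∘_; id)
open import Relation.Binary.PropositionalEquality as ≡ using (_≡_; _≢_)
open import Relation.Binary.Structures using (IsTotalOrder)
open import Relation.Nullary using (¬_; Dec; does; yes; no)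

module CyclicShift where
  open import Data.Fin using (fromℕ; inject₁)
  open import Data.Nat using (_+_; _%_; _∸_; NonZero)
  open import Data.Nat.DivMod
  import Data.Nat.Properties as ℕₚ

  m+[1+d]%n≢m : ∀ m d {n} .{{_ : NonZero n}} → suc d < n → (m + suc d) % n ≢ m
  m+[1+d]%n≢m m d {n} d<n eq with m + suc d ℕ.<? n
  ... | yes m+1+d<n = ℕₚ.m+1+n≢m m (≡.trans (≡.sym (m<n⇒m%n≡m m+1+d<n)) eq)
  ... | no m+1+d≮n = ℕₚ.<-irrefl ≡.refl (begin-strict
    m                      ≡⟨ eq ⟨
    (m + suc d) % n        ≡⟨ m≤n⇒[n∸m]%m≡n%m n≤m+1+d ⟨
    (m + suc d ∸ n) % n    ≤⟨ m%n≤m (m + suc d ∸ n) n ⟩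
    m + suc d ∸ n          <⟨ ℕₚ.∸-monoˡ-< (ℕₚ.+-monoʳ-< m d<n) n≤m+1+d ⟩
    m + n ∸ n              ≡⟨ ℕₚ.m+n∸n≡m m n ⟩
    m                      ∎)
    where
    open ℕₚ.≤-Reasoning
    n≤m+1+d : n ℕ.≤ m + suc d
    n≤m+1+d = ℕₚ.≮⇒≥ m+1+d≮n

  open ≡.≡-Reasoning

  [m%n+o]%n≡[m+o]%n : ∀ m o n .{{_ : NonZero n}} → (m % n + o) % n ≡ (m + o) % n
  [m%n+o]%n≡[m+o]%n m o n = begin
    (m % n + o) % n          ≡⟨ %-distribˡ-+ (m % n) o n ⟩
    (m % n % n + o % n) % n  ≡⟨ ≡.cong (λ r → (r + o % n) % n) (m%n%n≡m%n m n) ⟩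
    (m % n + o % n) % n      ≡⟨ %-distribˡ-+ m o n ⟨
    (m + o) % n              ∎

  shift : ∀ {m} → ℕ → Fin (suc m) → Fin (suc m)
  shift {m} k j = vtx m (toℕ j + k)

  toℕ-vtx : ∀ m k → toℕ (vtx m k) ≡ k % suc m
  toℕ-vtx m k = Finₚ.toℕ-fromℕ< (m%n<n k (suc m))

  shift-zero : ∀ {m} (j : Fin (suc m)) → shift 0 j ≡ j
  shift-zero {m} j = Finₚ.toℕ-injective (begin
    toℕ (shift 0 j)       ≡⟨ toℕ-vtx m (toℕ j + 0) ⟩
    (toℕ j + 0) % suc m   ≡⟨ ≡.cong (_% suc m) (ℕₚ.+-identityʳ (toℕ j)) ⟩
    toℕ j % suc m         ≡⟨ m<n⇒m%n≡m (Finₚ.toℕ<n j) ⟩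
    toℕ j                 ∎)

  shift-+ : ∀ {m} k l (j : Fin (suc m)) → shift (k + l) j ≡ shift l (shift k j)
  shift-+ {m} k l j = Finₚ.toℕ-injective (begin
    toℕ (shift (k + l) j)              ≡⟨ toℕ-vtx m (toℕ j + (k + l)) ⟩
    (toℕ j + (k + l)) % suc m          ≡⟨ ≡.cong (_% suc m) (ℕₚ.+-assoc (toℕ j) k l) ⟨
    (toℕ j + k + l) % suc m            ≡⟨ [m%n+o]%n≡[m+o]%n (toℕ j + k) l (suc m) ⟨
    ((toℕ j + k) % suc m + l) % suc m  ≡⟨ ≡.cong (λ r → (r + l) % suc m) (toℕ-vtx m (toℕ j + k)) ⟨
    (toℕ (shift k j) + l) % suc m      ≡⟨ toℕ-vtx m (toℕ (shift k j) + l) ⟨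
    toℕ (shift l (shift k j))          ∎)

  shift-≢ : ∀ {m} k d (j : Fin (suc m)) → suc d < suc m → shift (k + suc d) j ≢ shift k j
  shift-≢ {m} k d j d<n eq = m+[1+d]%n≢m (toℕ (shift k j)) d d<n (begin
    (toℕ (shift k j) + suc d) % suc m  ≡⟨ toℕ-vtx m (toℕ (shift k j) + suc d) ⟨
    toℕ (shift (suc d) (shift k j))    ≡⟨ ≡.cong toℕ (shift-+ k (suc d) j) ⟨
    toℕ (shift (k + suc d) j)          ≡⟨ ≡.cong toℕ eq ⟩
    toℕ (shift k j)                    ∎)

  shift-inject₁ : ∀ {m} (j : Fin m) → shift 1 (inject₁ j) ≡ Fin.suc j
  shift-inject₁ {m} j = Finₚ.toℕ-injective (begin
    toℕ (shift 1 (inject₁ j))      ≡⟨ toℕ-vtx m (toℕ (inject₁ j) + 1) ⟩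
    (toℕ (inject₁ j) + 1) % suc m  ≡⟨ ≡.cong (λ t → (t + 1) % suc m) (Finₚ.toℕ-inject₁ j) ⟩
    (toℕ j + 1) % suc m            ≡⟨ ≡.cong (_% suc m) (ℕₚ.+-comm (toℕ j) 1) ⟩
    suc (toℕ j) % suc m            ≡⟨ m<n⇒m%n≡m (s≤s (Finₚ.toℕ<n j)) ⟩
    suc (toℕ j)                    ∎)

  shift-fromℕ : ∀ m → shift 1 (fromℕ m) ≡ Fin.zero
  shift-fromℕ m = Finₚ.toℕ-injective (begin
    toℕ (shift 1 (fromℕ m))      ≡⟨ toℕ-vtx m (toℕ (fromℕ m) + 1) ⟩
    (toℕ (fromℕ m) + 1) % suc m  ≡⟨ ≡.cong (λ t → (t + 1) % suc m) (Finₚ.toℕ-fromℕ m) ⟩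
    (m + 1) % suc m              ≡⟨ ≡.cong (_% suc m) (ℕₚ.+-comm m 1) ⟩
    suc m % suc m                ≡⟨ n%n≡0 (suc m) ⟩
    0                            ∎)

open CyclicShift using (shift; shift-zero; shift-+; shift-≢; shift-inject₁; shift-fromℕ)

module FinSums {c ℓ} (M : CommutativeMonoid c ℓ) where
  open CommutativeMonoid M
  open import Algebra.Properties.CommutativeMonoid.Sum M public
  open import Relation.Binary.Reasoning.Setoid setoid

  when : ∀ {p} {P : Set p} → Dec P → Carrier → Carrier
  when P? x = if does P? then x else ε

  ∑-when-≟ˡ : ∀ {n} (a : Fin n) x → ∑[ i < n ] when (i ≟ a) x ≈ x
  ∑-when-≟ˡ {suc n} Fin.zero    x = trans (∙-congˡ (sum-replicate-zero n)) (identityʳ x)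
  ∑-when-≟ˡ {suc n} (Fin.suc a) x = trans (identityˡ _) (∑-when-≟ˡ a x)

  ∑-when-≟ʳ : ∀ {n} (a : Fin n) x → ∑[ i < n ] when (a ≟ i) x ≈ x
  ∑-when-≟ʳ {suc n} Fin.zero    x = trans (∙-congˡ (sum-replicate-zero n)) (identityʳ x)
  ∑-when-≟ʳ {suc n} (Fin.suc a) x = trans (identityˡ _) (∑-when-≟ʳ a x)

  ∑-shift₁ : ∀ {m} (f : Fin (suc m) → Carrier) → ∑[ j < suc m ] f (shift 1 j) ≈ sum f
  ∑-shift₁ {m} f = begin
    ∑[ j < suc m ] f (shift 1 j)                               ≈⟨ sum-init-last (f ∘ shift 1) ⟩
    ∑[ j < m ] f (shift 1 (Fin.inject₁ j)) ∙ f (shift 1 (Fin.fromℕ m))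
      ≡⟨ ≡.cong₂ _∙_ (sum-cong-≗ (≡.cong f ∘ shift-inject₁)) (≡.cong f (shift-fromℕ m)) ⟩
    ∑[ j < m ] f (Fin.suc j) ∙ f Fin.zero                      ≈⟨ comm _ _ ⟩
    sum f                                                      ∎

  ∑-shift : ∀ {m} k (f : Fin (suc m) → Carrier) → ∑[ j < suc m ] f (shift k j) ≈ sum f
  ∑-shift zero    f = reflexive (sum-cong-≗ (≡.cong f ∘ shift-zero))
  ∑-shift {m} (suc k) f = begin
    ∑[ j < suc m ] f (shift (suc k) j)    ≡⟨ sum-cong-≗ (≡.cong f ∘ shift-+ 1 k) ⟩
    ∑[ j < suc m ] f (shift k (shift 1 j)) ≈⟨ ∑-shift₁ (f ∘ shift k) ⟩
    ∑[ j < suc m ] f (shift k j)          ≈⟨ ∑-shift k f ⟩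
    sum f                                 ∎

Distinct : ∀ {n} → Edge n → Set
Distinct (a , b , c) = a ≢ b × a ≢ c × b ≢ c

tightCycleEdge : ∀ {m} → Fin (suc m) → Edge (suc m)
tightCycleEdge j = shift 1 j , shift 2 j , shift 3 j

tightCycle≡tabulate : ∀ m → tightCycle (suc m) ≡ tabulate (tightCycleEdge {m})
tightCycle≡tabulate m = map-tabulate id tightCycleEdge

tightCycleEdge-distinct : ∀ {m} (j : Fin (3 ℕ.+ m)) → Distinct (tightCycleEdge j)
tightCycleEdge-distinct {m} j =
  (λ eq → shift-≢ 1 0 j 1<n (≡.sym eq)) ,
  (λ eq → shift-≢ 1 1 j 2<n (≡.sym eq)) ,
  (λ eq → shift-≢ 2 0 j 1<n (≡.sym eq))
  where
  1<n : 1 < 3 ℕ.+ m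
  1<n = s≤s (s≤s z≤n)
  2<n : 2 < 3 ℕ.+ m
  2<n = s≤s (s≤s (s≤s z≤n))

tightCycle-distinct : ∀ m → All Distinct (tightCycle (3 ℕ.+ m))
tightCycle-distinct m = map⁺ (tabulate⁺ {f = id} tightCycleEdge-distinct)

module Degrees where
  open import Data.Nat using (_+_; _⊔_)
  import Data.Nat.Properties as ℕₚ
  open FinSums ℕₚ.+-0-commutativeMonoid
  open ≡.≡-Reasoning

  length-filter-tabulate : ∀ {a p} {A : Set a} {P : A → Set p} (P? : ∀ x → Dec (P x)) {k} (f : Fin k → A) →
    length (filter P? (tabulate f)) ≡ ∑[ j < k ] when (P? (f j)) 1
  length-filter-tabulate P? {zero}  f = ≡.refl
  length-filter-tabulate P? {suc k} f with does (P? (f Fin.zero))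
  ... | true  = ≡.cong suc (length-filter-tabulate P? (f ∘ Fin.suc))
  ... | false = length-filter-tabulate P? (f ∘ Fin.suc)

  when-∈ₑ : ∀ {n} (i : Fin n) {a b c} → Distinct (a , b , c) →
    when (i ∈ₑ? (a , b , c)) 1 ≡ when (i ≟ a) 1 + (when (i ≟ b) 1 + when (i ≟ c) 1)
  when-∈ₑ i {a} {b} {c} (a≢b , a≢c , b≢c) with i ≟ a | i ≟ b | i ≟ c
  ... | yes i≡a | yes i≡b | _       = ⊥-elim (a≢b (≡.trans (≡.sym i≡a) i≡b))
  ... | yes i≡a | no _    | yes i≡c = ⊥-elim (a≢c (≡.trans (≡.sym i≡a) i≡c))
  ... | yes _   | no _    | no _    = ≡.refl
  ... | no _    | yes i≡b | yes i≡c = ⊥-elim (b≢c (≡.trans (≡.sym i≡b) i≡c))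
  ... | no _    | yes _   | no _    = ≡.refl
  ... | no _    | no _    | yes _   = ≡.refl
  ... | no _    | no _    | no _    = ≡.refl

  tightCycle-regular : ∀ m (i : Fin (3 + m)) → degree (tightCycle (3 + m)) i ≡ 3
  tightCycle-regular m i = begin
    degree (tightCycle (3 + m)) i
      ≡⟨ ≡.cong (length ∘ filter (i ∈ₑ?_)) (tightCycle≡tabulate (2 + m)) ⟩
    length (filter (i ∈ₑ?_) (tabulate tightCycleEdge))
      ≡⟨ length-filter-tabulate (i ∈ₑ?_) tightCycleEdge ⟩
    ∑[ j < 3 + m ] when (i ∈ₑ? tightCycleEdge j) 1
      ≡⟨ sum-cong-≗ (λ j → when-∈ₑ i (tightCycleEdge-distinct j)) ⟩
    ∑[ j < 3 + m ] (hits 1 j + (hits 2 j + hits 3 j))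
      ≡⟨ ∑-distrib-+ (hits 1) (λ j → hits 2 j + hits 3 j) ⟩
    ∑[ j < 3 + m ] hits 1 j + ∑[ j < 3 + m ] (hits 2 j + hits 3 j)
      ≡⟨ ≡.cong (∑[ j < 3 + m ] hits 1 j +_) (∑-distrib-+ (hits 2) (hits 3)) ⟩
    ∑[ j < 3 + m ] hits 1 j + (∑[ j < 3 + m ] hits 2 j + ∑[ j < 3 + m ] hits 3 j)
      ≡⟨ ≡.cong₂ _+_ (∑-hits 1) (≡.cong₂ _+_ (∑-hits 2) (∑-hits 3)) ⟩
    3 ∎
    where
    hits : ℕ → Fin (3 + m) → ℕ
    hits k j = when (i ≟ shift k j) 1
    ∑-hits : ∀ k → ∑[ j < 3 + m ] hits k j ≡ 1
    ∑-hits k = ≡.trans (∑-shift k (λ y → when (i ≟ y) 1)) (∑-when-≟ʳ i 1)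

  maxDegree-regular : ∀ {n} (G : Hypergraph3 (suc n)) {d} → (∀ i → degree G i ≡ d) → maxDegree G ≡ d
  maxDegree-regular {n} G {d} regular = go id
    where
    go : ∀ {k} (h : Fin (suc k) → Fin (suc n)) → foldr (λ i m → degree G i ⊔ m) 0 (tabulate h) ≡ d
    go {zero}  h = ≡.trans (ℕₚ.⊔-identityʳ _) (regular (h Fin.zero))
    go {suc k} h = ≡.trans (≡.cong₂ _⊔_ (regular (h Fin.zero)) (go (h ∘ Fin.suc))) (ℕₚ.⊔-idem d)

module OrderedFieldProperties {c ℓ₁ ℓ₂} (F : OrderedField c ℓ₁ ℓ₂) where
  -- OrderedField._≤_ carries no fixity declaration (hence binds tighter than _+_ and _*_).
  open OrderedField F renaming (_≤_ to infix 4 _≤_)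
  open import Algebra.Properties.Ring ring
    using (-‿distribˡ-*; -‿distribʳ-*; -‿involutive; //-rightDividesˡ; //-rightDividesʳ)
  open import Algebra.Properties.CommutativeMonoid.Sum +-commutativeMonoid using (sum)
  open import Relation.Binary.Reasoning.Setoid setoid
  module ≤ = IsTotalOrder isTotalOrder

  x≈y-z⇒x+z≈y : ∀ {x y z} → x ≈ y - z → x + z ≈ y
  x≈y-z⇒x+z≈y {y = y} {z} eq = trans (+-congʳ eq) (//-rightDividesˡ z y)

  x+z≈y⇒x≈y-z : ∀ {x y z} → x + z ≈ y → x ≈ y - z
  x+z≈y⇒x≈y-z {x} {z = z} eq = trans (sym (//-rightDividesʳ z x)) (+-congʳ eq)

  x≤y⇒0≤y-x : ∀ {x y} → x ≤ y → 0# ≤ y - x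
  x≤y⇒0≤y-x {x} x≤y = ≤.≤-respˡ-≈ (-‿inverseʳ x) (+-mono-≤ (- x) x≤y)

  0≤y-x⇒x≤y : ∀ {x y} → 0# ≤ y - x → x ≤ y
  0≤y-x⇒x≤y {x} {y} 0≤y-x =
    ≤.≤-respˡ-≈ (+-identityˡ x) (≤.≤-respʳ-≈ (//-rightDividesˡ x y) (+-mono-≤ x 0≤y-x))

  x≤x+y : ∀ {x y} → 0# ≤ y → x ≤ x + y
  x≤x+y {x} {y} 0≤y = ≤.≤-respˡ-≈ (+-identityˡ x) (≤.≤-respʳ-≈ (+-comm y x) (+-mono-≤ x 0≤y))

  +-nonneg : ∀ {x y} → 0# ≤ x → 0# ≤ y → 0# ≤ x + y
  +-nonneg 0≤x 0≤y = ≤.trans 0≤x (x≤x+y 0≤y)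

  *-monoʳ-≤-nonneg : ∀ {x y z} → 0# ≤ z → x ≤ y → x * z ≤ y * z
  *-monoʳ-≤-nonneg {x} {y} {z} 0≤z x≤y =
    0≤y-x⇒x≤y (≤.≤-respʳ-≈ [y-x]z≈yz-xz (*-nonneg (x≤y⇒0≤y-x x≤y) 0≤z))
    where
    [y-x]z≈yz-xz : (y - x) * z ≈ y * z - x * z
    [y-x]z≈yz-xz = trans (distribʳ z y (- x)) (+-congˡ (sym (-‿distribˡ-* x z)))

  square-nonneg : ∀ x → 0# ≤ x * x
  square-nonneg x with ≤.total 0# x
  ... | inj₁ 0≤x = *-nonneg 0≤x 0≤x
  ... | inj₂ x≤0 = ≤.≤-respʳ-≈ -x*-x≈x*x (*-nonneg 0≤-x 0≤-x)
    where
    0≤-x : 0# ≤ - x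
    0≤-x = ≤.≤-respʳ-≈ (+-identityˡ (- x)) (x≤y⇒0≤y-x x≤0)
    -x*-x≈x*x : - x * - x ≈ x * x
    -x*-x≈x*x = begin
      - x * - x      ≈⟨ -‿distribˡ-* x (- x) ⟨
      - (x * - x)    ≈⟨ -‿cong (-‿distribʳ-* x x) ⟨
      - (- (x * x))  ≈⟨ -‿involutive (x * x) ⟩
      x * x          ∎

  *-cancelʳ-≈ : ∀ {x y z} → ¬ (z ≈ 0#) → x * z ≈ y * z → x ≈ y
  *-cancelʳ-≈ {x} {y} {z} z≉0 eq with inverse z z≉0
  ... | z⁻¹ , zz⁻¹≈1 = begin
    x              ≈⟨ *-identityʳ x ⟨
    x * 1#         ≈⟨ *-congˡ zz⁻¹≈1 ⟨
    x * (z * z⁻¹)  ≈⟨ *-assoc x z z⁻¹ ⟨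
    x * z * z⁻¹    ≈⟨ *-congʳ eq ⟩
    y * z * z⁻¹    ≈⟨ *-assoc y z z⁻¹ ⟩
    y * (z * z⁻¹)  ≈⟨ *-congˡ zz⁻¹≈1 ⟩
    y * 1#         ≈⟨ *-identityʳ y ⟩
    y              ∎

  square-≉0 : ∀ {x} → ¬ (x ≈ 0#) → ¬ (x * x ≈ 0#)
  square-≉0 {x} x≉0 xx≈0 = x≉0 (*-cancelʳ-≈ x≉0 (trans xx≈0 (sym (zeroˡ x))))

  x*z+t≈y*z⇒x≤y : ∀ {x y z t} → 0# ≤ z → ¬ (z ≈ 0#) → 0# ≤ t → x * z + t ≈ y * z → x ≤ y
  x*z+t≈y*z⇒x≤y {x} {y} {z} 0≤z z≉0 0≤t eq with ≤.total x y
  ... | inj₁ x≤y = x≤y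
  ... | inj₂ y≤x = ≤.reflexive (*-cancelʳ-≈ z≉0 (≤.antisym xz≤yz (*-monoʳ-≤-nonneg 0≤z y≤x)))
    where
    xz≤yz : x * z ≤ y * z
    xz≤yz = ≤.≤-respʳ-≈ eq (x≤x+y 0≤t)

  ∑-nonneg : ∀ {n} (f : Fin n → Carrier) → (∀ i → 0# ≤ f i) → 0# ≤ sum f
  ∑-nonneg {zero}  f 0≤f = ≤.refl
  ∑-nonneg {suc n} f 0≤f = +-nonneg (0≤f Fin.zero) (∑-nonneg (f ∘ Fin.suc) (0≤f ∘ Fin.suc))

  ∑-nonneg-≈0 : ∀ {n} (f : Fin n → Carrier) → (∀ i → 0# ≤ f i) → sum f ≈ 0# → ∀ i → f i ≈ 0#
  ∑-nonneg-≈0 f 0≤f ∑≈0 Fin.zero =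
    ≤.antisym (≤.≤-respʳ-≈ ∑≈0 (x≤x+y (∑-nonneg (f ∘ Fin.suc) (0≤f ∘ Fin.suc)))) (0≤f Fin.zero)
  ∑-nonneg-≈0 f 0≤f ∑≈0 (Fin.suc i) =
    ∑-nonneg-≈0 (f ∘ Fin.suc) (0≤f ∘ Fin.suc)
      (≤.antisym (≤.≤-respʳ-≈ (trans (+-comm _ _) ∑≈0) (x≤x+y (0≤f Fin.zero)))
                 (∑-nonneg (f ∘ Fin.suc) (0≤f ∘ Fin.suc)))
      i

module LaplacianHEigenvalues {c ℓ₁ ℓ₂} (F : OrderedField c ℓ₁ ℓ₂) where
  open OrderedField F renaming (_≤_ to infix 4 _≤_)
  open OrderedFieldProperties F
  open FinSums +-commutativeMonoid
  open import Algebra.Properties.Semiring.Sum semiring using (*-distribˡ-sum)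
  open import Algebra.Properties.CommutativeSemigroup +-commutativeSemigroup using (interchange)
  open import Algebra.Solver.Ring.NaturalCoefficients.Default commutativeSemiring
  open import Relation.Binary.Reasoning.Setoid setoid

  ‖_‖² : ∀ {n} → (Fin n → Carrier) → Carrier
  ‖ x ‖² = sum (λ i → x i * x i)

  pairSum vertexSquares edgeSquare : ∀ {n} → (Fin n → Carrier) → Edge n → Carrier
  pairSum       x (a , b , c) = x b * x c + (x a * x c + x a * x b)
  vertexSquares x (a , b , c) = x a * x a + (x b * x b + x c * x c)
  edgeSquare    x (a , b , c) = (x a + x b + x c) * (x a + x b + x c)

  -- ⟦ numeral n ⟧ reduces to fromℕ n, which lets the solver see the field's numerals.
  numeral : ∀ {k} → ℕ → Polynomial k
  numeral zero    = con 0
  numeral (suc n) = con 1 :+ numeral n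

  square-of-sum₃ : ∀ a b c → (a + b + c) * (a + b + c) ≈
    (a * a + (b * b + c * c)) + ((b * c + (a * c + a * b)) + (b * c + (a * c + a * b)))
  square-of-sum₃ = solve 3 (λ a b c → (a :+ b :+ c) :* (a :+ b :+ c) :=
    (a :* a :+ (b :* b :+ c :* c)) :+ ((b :* c :+ (a :* c :+ a :* b)) :+ (b :* c :+ (a :* c :+ a :* b)))) refl

  Σₑ-cong : ∀ {n} {G : Hypergraph3 n} {f g : Edge n → Carrier} →
    All (λ e → f e ≈ g e) G → Σₑ F G f ≈ Σₑ F G g
  Σₑ-cong []       = refl
  Σₑ-cong (p ∷ ps) = +-cong p (Σₑ-cong ps)

  Σₑ-+ : ∀ {n} (G : Hypergraph3 n) (f g : Edge n → Carrier) →
    Σₑ F G (λ e → f e + g e) ≈ Σₑ F G f + Σₑ F G g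
  Σₑ-+ []      f g = sym (+-identityʳ 0#)
  Σₑ-+ (e ∷ G) f g = trans (+-congˡ (Σₑ-+ G f g)) (interchange (f e) (g e) _ _)

  Σₑ-nonneg : ∀ {n} (G : Hypergraph3 n) (f : Edge n → Carrier) → (∀ e → 0# ≤ f e) → 0# ≤ Σₑ F G f
  Σₑ-nonneg []      f 0≤f = ≤.refl
  Σₑ-nonneg (e ∷ G) f 0≤f = +-nonneg (0≤f e) (Σₑ-nonneg G f 0≤f)

  Σₑ-tabulate : ∀ {n k} (g : Fin k → Edge n) (f : Edge n → Carrier) →
    Σₑ F (tabulate g) f ≈ ∑[ j < k ] f (g j)
  Σₑ-tabulate {k = zero}  g f = refl
  Σₑ-tabulate {k = suc k} g f = +-congˡ (Σₑ-tabulate (g ∘ Fin.suc) f)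

  ∑-Σₑ-comm : ∀ {n m} (G : Hypergraph3 n) (f : Fin m → Edge n → Carrier) →
    ∑[ i < m ] Σₑ F G (f i) ≈ Σₑ F G (λ e → ∑[ i < m ] f i e)
  ∑-Σₑ-comm {m = m} [] f = sum-replicate-zero m
  ∑-Σₑ-comm (e ∷ G) f =
    trans (∑-distrib-+ (λ i → f i e) (λ i → Σₑ F G (f i))) (+-congˡ (∑-Σₑ-comm G f))

  adjTerm-distinct : ∀ {n} (x : Fin n → Carrier) (i : Fin n) {a b c} → Distinct (a , b , c) →
    adjTerm F x i (a , b , c) ≈ when (i ≟ a) (x b * x c) + (when (i ≟ b) (x a * x c) + when (i ≟ c) (x a * x b))
  adjTerm-distinct x i {a} {b} {c} (a≢b , a≢c , b≢c) with i ≟ a | i ≟ b | i ≟ c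
  ... | yes i≡a | yes i≡b | _       = ⊥-elim (a≢b (≡.trans (≡.sym i≡a) i≡b))
  ... | yes i≡a | no _    | yes i≡c = ⊥-elim (a≢c (≡.trans (≡.sym i≡a) i≡c))
  ... | yes _   | no _    | no _    = sym (trans (+-congˡ (+-identityˡ 0#)) (+-identityʳ _))
  ... | no _    | yes i≡b | yes i≡c = ⊥-elim (b≢c (≡.trans (≡.sym i≡b) i≡c))
  ... | no _    | yes _   | no _    = sym (trans (+-identityˡ _) (+-identityʳ _))
  ... | no _    | no _    | yes _   = sym (trans (+-identityˡ _) (+-identityˡ _))
  ... | no _    | no _    | no _    = sym (trans (+-identityˡ _) (+-identityˡ _))

  ∑-adjTerm : ∀ {n} (x : Fin n → Carrier) {e} → Distinct e → ∑[ i < n ] adjTerm F x i e ≈ pairSum x e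
  ∑-adjTerm {n} x {a , b , c} distinct = begin
    ∑[ i < n ] adjTerm F x i (a , b , c)
      ≈⟨ sum-cong-≋ (λ i → adjTerm-distinct x i distinct) ⟩
    ∑[ i < n ] (hit a (x b * x c) i + (hit b (x a * x c) i + hit c (x a * x b) i))
      ≈⟨ ∑-distrib-+ (hit a (x b * x c)) _ ⟩
    ∑[ i < n ] hit a (x b * x c) i + ∑[ i < n ] (hit b (x a * x c) i + hit c (x a * x b) i)
      ≈⟨ +-congˡ (∑-distrib-+ (hit b (x a * x c)) (hit c (x a * x b))) ⟩
    ∑[ i < n ] hit a (x b * x c) i + (∑[ i < n ] hit b (x a * x c) i + ∑[ i < n ] hit c (x a * x b) i)
      ≈⟨ +-cong (∑-when-≟ˡ a _) (+-cong (∑-when-≟ˡ b _) (∑-when-≟ˡ c _)) ⟩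
    pairSum x (a , b , c) ∎
    where
    hit : Fin n → Carrier → Fin n → Carrier
    hit v y i = when (i ≟ v) y

  regular-eigen-sum : ∀ {n} {G : Hypergraph3 n} {d μ x} → (∀ i → degree G i ≡ d) → All Distinct G →
    IsHEigenpair F G μ x → μ * ‖ x ‖² + Σₑ F G (pairSum x) ≈ fromℕ d * ‖ x ‖²
  regular-eigen-sum {n} {G} {d} {μ} {x} regular distinct (_ , eigen) = begin
    μ * ‖ x ‖² + Σₑ F G (pairSum x)
      ≈⟨ +-cong (*-distribˡ-sum μ (λ i → x i * x i)) (sym adjacencySum) ⟩
    ∑[ i < n ] (μ * (x i * x i)) + ∑[ i < n ] Σₑ F G (adjTerm F x i)
      ≈⟨ ∑-distrib-+ (λ i → μ * (x i * x i)) (λ i → Σₑ F G (adjTerm F x i)) ⟨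
    ∑[ i < n ] (μ * (x i * x i) + Σₑ F G (adjTerm F x i))
      ≈⟨ sum-cong-≋ vertexEquation ⟩
    ∑[ i < n ] (fromℕ d * (x i * x i))
      ≈⟨ *-distribˡ-sum (fromℕ d) (λ i → x i * x i) ⟨
    fromℕ d * ‖ x ‖² ∎
    where
    adjacencySum : ∑[ i < n ] Σₑ F G (adjTerm F x i) ≈ Σₑ F G (pairSum x)
    adjacencySum = trans (∑-Σₑ-comm G (λ i → adjTerm F x i)) (Σₑ-cong (All.map (∑-adjTerm x) distinct))
    vertexEquation : ∀ i → μ * (x i * x i) + Σₑ F G (adjTerm F x i) ≈ fromℕ d * (x i * x i)
    vertexEquation i = x≈y-z⇒x+z≈y (≡.subst
      (λ k → μ * (x i * x i) ≈ fromℕ k * (x i * x i) - Σₑ F G (adjTerm F x i)) (regular i) (eigen i))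

  Σₑ-edgeSquare : ∀ {n} (G : Hypergraph3 n) (x : Fin n → Carrier) →
    Σₑ F G (edgeSquare x) ≈ Σₑ F G (vertexSquares x) + (Σₑ F G (pairSum x) + Σₑ F G (pairSum x))
  Σₑ-edgeSquare G x = begin
    Σₑ F G (edgeSquare x)
      ≈⟨ Σₑ-cong (All.universal (λ (a , b , c) → square-of-sum₃ (x a) (x b) (x c)) G) ⟩
    Σₑ F G (λ e → vertexSquares x e + (pairSum x e + pairSum x e))
      ≈⟨ Σₑ-+ G (vertexSquares x) _ ⟩
    Σₑ F G (vertexSquares x) + Σₑ F G (λ e → pairSum x e + pairSum x e)
      ≈⟨ +-congˡ (Σₑ-+ G (pairSum x) (pairSum x)) ⟩
    Σₑ F G (vertexSquares x) + (Σₑ F G (pairSum x) + Σₑ F G (pairSum x)) ∎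

  tightCycle-vertexSquares : ∀ m (x : Fin (suc m) → Carrier) →
    Σₑ F (tightCycle (suc m)) (vertexSquares x) ≈ ‖ x ‖² + (‖ x ‖² + ‖ x ‖²)
  tightCycle-vertexSquares m x = begin
    Σₑ F (tightCycle (suc m)) (vertexSquares x)
      ≡⟨ ≡.cong (λ G → Σₑ F G (vertexSquares x)) (tightCycle≡tabulate m) ⟩
    Σₑ F (tabulate tightCycleEdge) (vertexSquares x)
      ≈⟨ Σₑ-tabulate tightCycleEdge (vertexSquares x) ⟩
    ∑[ j < suc m ] (sq (shift 1 j) + (sq (shift 2 j) + sq (shift 3 j)))
      ≈⟨ ∑-distrib-+ (sq ∘ shift 1) (λ j → sq (shift 2 j) + sq (shift 3 j)) ⟩
    ∑[ j < suc m ] sq (shift 1 j) + ∑[ j < suc m ] (sq (shift 2 j) + sq (shift 3 j))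
      ≈⟨ +-congˡ (∑-distrib-+ (sq ∘ shift 2) (sq ∘ shift 3)) ⟩
    ∑[ j < suc m ] sq (shift 1 j) + (∑[ j < suc m ] sq (shift 2 j) + ∑[ j < suc m ] sq (shift 3 j))
      ≈⟨ +-cong (∑-shift 1 sq) (+-cong (∑-shift 2 sq) (∑-shift 3 sq)) ⟩
    ‖ x ‖² + (‖ x ‖² + ‖ x ‖²) ∎
    where
    sq : Fin (suc m) → Carrier
    sq i = x i * x i

  ‖‖²-nonneg : ∀ {n} (x : Fin n → Carrier) → 0# ≤ ‖ x ‖²
  ‖‖²-nonneg x = ∑-nonneg _ (λ i → square-nonneg (x i))

  ‖‖²-≉0 : ∀ {n} {x : Fin n → Carrier} → ∃[ i ] ¬ (x i ≈ 0#) → ¬ (‖ x ‖² ≈ 0#)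
  ‖‖²-≉0 {x = x} (i , xᵢ≉0) ‖x‖²≈0 =
    square-≉0 xᵢ≉0 (∑-nonneg-≈0 _ (λ j → square-nonneg (x j)) ‖x‖²≈0 i)

  tightCycle-eigenvalue-bound : ∀ m {μ} →
    IsLaplacianHEigenvalue F (tightCycle (3 ℕ.+ m)) μ → μ + μ ≤ fromℕ 9
  tightCycle-eigenvalue-bound m {μ} (x , eigenpair@(nonzero , _)) =
    x*z+t≈y*z⇒x≤y (‖‖²-nonneg x) (‖‖²-≉0 nonzero)
      (Σₑ-nonneg G (edgeSquare x) edgeSquare-nonneg) identity
    where
    G : Hypergraph3 (3 ℕ.+ m)
    G = tightCycle (3 ℕ.+ m)
    S P : Carrier
    S = ‖ x ‖²
    P = Σₑ F G (pairSum x)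
    edgeSquare-nonneg : ∀ e → 0# ≤ edgeSquare x e
    edgeSquare-nonneg (a , b , c) = square-nonneg (x a + x b + x c)
    identity : (μ + μ) * S + Σₑ F G (edgeSquare x) ≈ fromℕ 9 * S
    identity = begin
      (μ + μ) * S + Σₑ F G (edgeSquare x)
        ≈⟨ +-congˡ (Σₑ-edgeSquare G x) ⟩
      (μ + μ) * S + (Σₑ F G (vertexSquares x) + (P + P))
        ≈⟨ solve 4 (λ μ S Q P → (μ :+ μ) :* S :+ (Q :+ (P :+ P)) := (μ :* S :+ P) :+ (μ :* S :+ P) :+ Q)
             refl μ S (Σₑ F G (vertexSquares x)) P ⟩
      (μ * S + P) + (μ * S + P) + Σₑ F G (vertexSquares x)
        ≈⟨ +-cong (+-cong eigenSum eigenSum) (tightCycle-vertexSquares (2 ℕ.+ m) x) ⟩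
      fromℕ 3 * S + fromℕ 3 * S + (S + (S + S))
        ≈⟨ solve 1 (λ S → numeral 3 :* S :+ numeral 3 :* S :+ (S :+ (S :+ S)) := numeral 9 :* S) refl S ⟩
      fromℕ 9 * S ∎
      where
      eigenSum : μ * S + P ≈ fromℕ 3 * S
      eigenSum = regular-eigen-sum (Degrees.tightCycle-regular m) (tightCycle-distinct m) eigenpair

  tightCycle₄-square : ∀ (x : Fin 4 → Carrier) →
    (x 0F + x 1F + x 2F + x 3F) * (x 0F + x 1F + x 2F + x 3F) ≈ ‖ x ‖² + Σₑ F (tightCycle 4) (pairSum x)
  -- The solver's right-hand side is ‖ x ‖² + Σₑ F (tightCycle 4) (pairSum x) unfolded along the
  -- edges (1,2,3), (2,3,0), (3,0,1), (0,1,2).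
  tightCycle₄-square x = solve 4 (λ a b c d → (a :+ b :+ c :+ d) :* (a :+ b :+ c :+ d) :=
      (a :* a :+ (b :* b :+ (c :* c :+ (d :* d :+ con 0)))) :+
      ((c :* d :+ (b :* d :+ b :* c)) :+ ((d :* a :+ (c :* a :+ c :* d)) :+
        ((a :* b :+ (d :* b :+ d :* a)) :+ ((b :* c :+ (a :* c :+ a :* b)) :+ con 0)))))
    refl (x 0F) (x 1F) (x 2F) (x 3F)

  tightCycle₄-eigenvalue-bound : ∀ {μ} → IsLaplacianHEigenvalue F (tightCycle 4) μ → μ ≤ fromℕ 4
  tightCycle₄-eigenvalue-bound {μ} (x , eigenpair@(nonzero , _)) =
    x*z+t≈y*z⇒x≤y (‖‖²-nonneg x) (‖‖²-≉0 nonzero) (square-nonneg σ) identity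
    where
    σ S P : Carrier
    σ = x 0F + x 1F + x 2F + x 3F
    S = ‖ x ‖²
    P = Σₑ F (tightCycle 4) (pairSum x)
    identity : μ * S + σ * σ ≈ fromℕ 4 * S
    identity = begin
      μ * S + σ * σ        ≈⟨ +-congˡ (tightCycle₄-square x) ⟩
      μ * S + (S + P)      ≈⟨ solve 3 (λ μ S P → μ :* S :+ (S :+ P) := (μ :* S :+ P) :+ S) refl μ S P ⟩
      (μ * S + P) + S      ≈⟨ +-congʳ eigenSum ⟩
      fromℕ 3 * S + S      ≈⟨ solve 1 (λ S → numeral 3 :* S :+ S := numeral 4 :* S) refl S ⟩
      fromℕ 4 * S          ∎
      where
      eigenSum : μ * S + P ≈ fromℕ 3 * S
      eigenSum = regular-eigen-sum (Degrees.tightCycle-regular 1) (tightCycle-distinct 1) eigenpair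

  x₄ : Fin 4 → Carrier
  x₄ 0F = 1#
  x₄ 1F = 1#
  x₄ 2F = - 1#
  x₄ 3F = - 1#

  -- With v := - 1#, each vertex equation becomes a semiring identity in v once the vanishing term
  -- (1# + v)² is added, which the negation-free solver can check.
  tightCycle₄-eigenpair : IsHEigenpair F (tightCycle 4) (fromℕ 4) x₄
  tightCycle₄-eigenpair = (0F , λ 1≈0 → nontrivial (sym 1≈0)) , equation
    where
    one : Polynomial 1
    one = con 1
    y≈z+[1-1]q⇒y≈z : ∀ {y z} q → y ≈ z + (1# - 1#) * q → y ≈ z
    y≈z+[1-1]q⇒y≈z {z = z} q eq =
      trans eq (trans (+-congˡ (trans (*-congʳ (-‿inverseʳ 1#)) (zeroˡ q))) (+-identityʳ z))
    equation : ∀ i → fromℕ 4 * (x₄ i * x₄ i) ≈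
      fromℕ (degree (tightCycle 4) i) * (x₄ i * x₄ i) - Σₑ F (tightCycle 4) (adjTerm F x₄ i)
    equation 0F = x+z≈y⇒x≈y-z (y≈z+[1-1]q⇒y≈z (1# - 1#) (solve 1 (λ v →
      numeral 4 :* (one :* one) :+ (con 0 :+ (v :* v :+ (v :* one :+ (one :* v :+ con 0)))) :=
      numeral 3 :* (one :* one) :+ (one :+ v) :* (one :+ v)) refl (- 1#)))
    equation 1F = x+z≈y⇒x≈y-z (y≈z+[1-1]q⇒y≈z (1# - 1#) (solve 1 (λ v →
      numeral 4 :* (one :* one) :+ (v :* v :+ (con 0 :+ (v :* one :+ (one :* v :+ con 0)))) :=
      numeral 3 :* (one :* one) :+ (one :+ v) :* (one :+ v)) refl (- 1#)))
    equation 2F = x+z≈y⇒x≈y-z (y≈z+[1-1]q⇒y≈z (1# - 1#) (solve 1 (λ v →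
      numeral 4 :* (v :* v) :+ (one :* v :+ (v :* one :+ (con 0 :+ (one :* one :+ con 0)))) :=
      numeral 3 :* (v :* v) :+ (one :+ v) :* (one :+ v)) refl (- 1#)))
    equation 3F = x+z≈y⇒x≈y-z (y≈z+[1-1]q⇒y≈z (1# - 1#) (solve 1 (λ v →
      numeral 4 :* (v :* v) :+ (one :* v :+ (v :* one :+ (one :* one :+ (con 0 :+ con 0)))) :=
      numeral 3 :* (v :* v) :+ (one :+ v) :* (one :+ v)) refl (- 1#)))

open import Data.Nat using (_≤_)

proposition8p2 : ∀ {c ℓ₁ ℓ₂} (F : OrderedField c ℓ₁ ℓ₂) (n : ℕ) → 4 ≤ n →
    (maxDegree (tightCycle n) ≡ 3)
    × (n ≡ 4 → IsLargestLaplacianHEigenvalue F (tightCycle n) (OrderedField.fromℕ F 4))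
    × (5 ≤ n → ∀ μ → IsLaplacianHEigenvalue F (tightCycle n) μ →
         OrderedField._≤_ F (OrderedField._+_ F μ μ) (OrderedField.fromℕ F 9))
proposition8p2 F (suc (suc (suc (suc m)))) (s≤s (s≤s (s≤s (s≤s z≤n)))) =
  Degrees.maxDegree-regular (tightCycle (4 ℕ.+ m)) (Degrees.tightCycle-regular (suc m)) ,
  largest ,
  (λ _ μ → tightCycle-eigenvalue-bound (suc m))
  where
  open LaplacianHEigenvalues F
  largest : 4 ℕ.+ m ≡ 4 → IsLargestLaplacianHEigenvalue F (tightCycle (4 ℕ.+ m)) (OrderedField.fromℕ F 4)
  largest ≡.refl = (x₄ , tightCycle₄-eigenpair) , λ μ → tightCycle₄-eigenvalue-bound
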